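{- Let $\mathcal{M}$ be an oriented matroid on $E$ and $i\in E$. Then $\mathcal{E}_{\mathcal{M}/i}=\mathcal{E}_{\mathcal{M}}/i$ and $\mathcal{E}_{\mathcal{M}\setminus i}=\mathcal{E}_{\mathcal{M}}\setminus i$.
   Context: $\mathbb{Z}_2=\mathbb{Z}/2\mathbb{Z}$. Matroid fan: for a loopfree matroid $M$ on $E$, $v_i=-e_i$, $v_I=\sum_{i\in I}v_i$; for each chain of flats $\mathcal{F}=\{\emptyset\subsetneq F_1\subsetneq\dots\subsetneq F_k\subsetneq E\}$, $\sigma_{\mathcal{F}}$ is the cone generated by $v_{F_1},\dots,v_{F_k},v_E,-v_E$; $\Sigma_M$ consists of these cones. If $M$ has loops $L$, $\Sigma_M:=\Sigma_{M/L}\subset\mathbb{R}^{E\setminus L}$. $p_A$ forgets coordinates in $A$ (over $\mathbb{R}$ and mod 2), $p_i=p_{\{i\}}$ ($=\mathrm{id}$ for a loop). Oriented matroids: covectors $\mathcal{C}\subseteq\{0,\pm1\}^E$; underlying flats $E\setminus\mathrm{Supp}(X)$; topes are maximal covectors; $T\setminus F$ sets coordinates in $F$ to $0$; $\mathcal{T}(\mathcal{F})$ = topes $T$ with $T\setminus F\in\mathcal{C}$ for all flats $F$ of the chain $\mathcal{F}$; $(-1)^\varepsilon=((-1)^{\varepsilon_e})_e$. For loopfree $\mathcal{M}$, $\mathcal{E}_{\mathcal{M}}(\sigma_{\mathcal{F}})=\{\varepsilon\in\mathbb{Z}_2^E:(-1)^\varepsilon\in\mathcal{T}(\mathcal{F})\}$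 on facets; with loops $L$, $\mathcal{E}_{\mathcal{M}}:=\mathcal{E}_{\mathcal{M}\setminus L}$. The covectors of $\mathcal{M}\setminus i$ are the restrictions $p_i(X)$ of covectors $X$ of $\mathcal{M}$, and those of $\mathcal{M}/i$ are the $p_i(X)$ for covectors $X$ with $X_i=0$. Deletion/contraction of a real phase structure $\mathcal{E}$ on $\Sigma_M$: for a facet $\sigma$ of $\Sigma_{M\setminus i}$, $p_i^*(\sigma)$ is the facet of $\Sigma_M$ whose chain consists of the $M$-closures of the flats of $\sigma$'s chain if $i$ is not a coloop, and, if $i$ is a coloop, the chain obtained by adding $i$ to each flat and prolonging by one step; $(\mathcal{E}\setminus i)(\sigma)=p_i(\mathcal{E}(p_i^*(\sigma)))$. For a facet $\sigma$ of $\Sigma_{M/i}=\Sigma_{M/\mathrm{cl}(i)}$ with chain $\emptyset\subsetneq F_1\subsetneq\dots\subsetneq F_l\subsetneq E\setminus\mathrm{cl}(i)$, $p^\diamond_{\mathrm{cl}(i)}(\sigma)$ is the facet of $\Sigma_M$ with chain $\mathrm{cl}(\emptyset)\subseteq\mathrm{cl}(i)\subsetneq F_1\sqcup\mathrm{cl}(i)\subsetneq\dots\subsetneq F_l\sqcup\mathrm{cl}(i)\subsetneq E$, and $(\mathcal{E}/i)(\sigma)=p_{\mathrm{cl}(i)}(\mathcal{E}(p^\diamond_{\mathrm{cl}(i)}(\sigma)))$. -}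

module Defs where

open import Data.Nat using (ℕ)
open import Data.Bool using (Bool; true; false; if_then_else_)
import Data.Bool as Bool
open import Data.Fin using (Fin)
open import Data.Fin.Subset using (Subset; _∈_; _∉_; _⊆_; _⊂_; _∩_; _∪_; _─_; ⁅_⁆; ⊥)
open import Data.Fin.Subset.Properties using (_∈?_; _⊆?_)
open import Data.Vec using (Vec; lookup; zipWith; replicate)
import Data.Vec as Vec
open import Data.Vec.Properties using (≡-dec)
open import Data.List using (List; []; _∷_; _++_; [_]; filter; foldr)
import Data.List as List
open import Data.List.Relation.Unary.All using (All)
open import Data.List.Relation.Unary.Any using (any?)
open import Data.List.Relation.Unary.Linked using (Linked)
import Data.List.Membership.Propositional as LM
open import Data.Product using (Σ; ∃; _×_; _,_)
open import Relation.Binary.PropositionalEquality using (_≡_; _≢_)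
open import Relation.Nullary using (¬_; does)

-- Signs and sign vectors.  The ground set is (a subset S of) Fin n;
-- vectors indexed by S are encoded as length-n vectors which are
-- zero (resp. false) outside S ("padding convention").

data Sign : Set where
  zer pos neg : Sign

-sgn : Sign → Sign
-sgn zer = zer
-sgn pos = neg
-sgn neg = pos

isZero : Sign → Bool
isZero zer = true
isZero _   = false

SignVec : ℕ → Set
SignVec n = Vec Sign n

_∈ᴸ_ : ∀ {n} → SignVec n → List (SignVec n) → Set
X ∈ᴸ C = X LM.∈ C

negV : ∀ {n} → SignVec n → SignVec n
negV = Vec.map -sgn

compS : Sign → Sign → Sign
compS zer y = y
compS x   _ = x

_∘ˢ_ : ∀ {n} → SignVec n → SignVec n → SignVec n
_∘ˢ_ = zipWith compS

Sep : ∀ {n} → SignVec n → SignVec n → Fin n → Set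
Sep X Y e = (lookup X e ≢ zer) × (lookup X e ≡ -sgn (lookup Y e))

_≼_ : ∀ {n} → SignVec n → SignVec n → Set
X ≼ Y = ∀ e → (lookup X e ≡ zer) Data.Sum.⊎ (lookup X e ≡ lookup Y e)
  where import Data.Sum

zeros : ∀ {n} → SignVec n → Subset n
zeros = Vec.map isZero

pS : ∀ {n} → Subset n → SignVec n → SignVec n
pS = zipWith (λ a x → if a then zer else x)

pB : ∀ {n} → Subset n → Vec Bool n → Vec Bool n
pB = zipWith (λ a x → if a then false else x)

-- (-1)^ε, as a sign vector on the ground set S (padded by 0)
signOf : ∀ {n} → Subset n → Vec Bool n → SignVec n
signOf = zipWith (λ s b → if s then (if b then neg else pos) else zer)

record RawOM (n : ℕ) : Set where
  constructor mkOM
  field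
    ground : Subset n
    cov    : List (SignVec n)
open RawOM public

record IsOrientedMatroid {n : ℕ} (M : RawOM n) : Set where
  field
    supported : ∀ {X} → X ∈ᴸ cov M → ∀ e → e ∉ ground M → lookup X e ≡ zer
    cov-zero  : replicate n zer ∈ᴸ cov M
    cov-neg   : ∀ {X} → X ∈ᴸ cov M → negV X ∈ᴸ cov M
    cov-comp  : ∀ {X Y} → X ∈ᴸ cov M → Y ∈ᴸ cov M → (X ∘ˢ Y) ∈ᴸ cov M
    cov-elim  : ∀ {X Y} → X ∈ᴸ cov M → Y ∈ᴸ cov M → ∀ e → Sep X Y e →
                Σ (SignVec n) λ Z → Z ∈ᴸ cov M × lookup Z e ≡ zer ×
                  (∀ f → ¬ Sep X Y f → lookup Z f ≡ lookup (X ∘ˢ Y) f)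

module _ {n : ℕ} where

  zeroSet : RawOM n → SignVec n → Subset n
  zeroSet M X = ground M ∩ zeros X

  IsFlat : RawOM n → Subset n → Set
  IsFlat M F = Σ (SignVec n) λ X → X ∈ᴸ cov M × F ≡ zeroSet M X

  cl : RawOM n → Subset n → Subset n
  cl M A = foldr _∩_ (ground M)
             (List.map (zeroSet M) (filter (λ X → A ⊆? zeroSet M X) (cov M)))

  loops : RawOM n → Subset n
  loops M = cl M ⊥

  isColoop : RawOM n → Fin n → Bool
  isColoop M i = does (any? (λ X → ≡-dec Bool._≟_ (ground M ─ ⁅ i ⁆) (zeroSet M X)) (cov M))

  isLoop : RawOM n → Fin n → Bool
  isLoop M i = does (i ∈? loops M)

  deleteSet : RawOM n → Subset n → RawOM n
  deleteSet M A = mkOM (ground M ─ A) (List.map (pS A) (cov M))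

  contractSet : RawOM n → Subset n → RawOM n
  contractSet M A = mkOM (ground M ─ A)
                      (List.map (pS A) (filter (λ X → A ⊆? zeros X) (cov M)))

  _∖ₘ_ : RawOM n → Fin n → RawOM n
  M ∖ₘ i = deleteSet M ⁅ i ⁆

  _/ₘ_ : RawOM n → Fin n → RawOM n
  M /ₘ i = contractSet M ⁅ i ⁆

  IsTope : RawOM n → SignVec n → Set
  IsTope M T = T ∈ᴸ cov M × (∀ Y → Y ∈ᴸ cov M → T ≼ Y → Y ≡ T)

  -- A chain of flats
  -- ∅ ⊊ F₁ ⊊ … ⊊ F_k ⊊ S is given by the list [F₁, …, F_k]; the facets
  -- are the cones of the maximal chains.  For M with loops L,
  -- Σ_M := Σ_{M/L}.

  Covers : RawOM n → Subset n → Subset n → Set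
  Covers M A B = A ⊂ B × ¬ (Σ (Subset n) λ G → IsFlat M G × A ⊂ G × G ⊂ B)

  IsMaxChainLF : RawOM n → List (Subset n) → Set
  IsMaxChainLF M Fs = All (IsFlat M) Fs × Linked (Covers M) (⊥ ∷ Fs ++ [ ground M ])

  IsFacet : RawOM n → List (Subset n) → Set
  IsFacet M σ = IsMaxChainLF (contractSet M (loops M)) σ

  -- Real phase structures, given as predicates on (chain, ε);
  -- ε ∈ Z₂^E encoded as Vec Bool n.

  PhaseStr : Set₁
  PhaseStr = List (Subset n) → Vec Bool n → Set

  phaseLF : RawOM n → PhaseStr
  phaseLF M σ ε =
    (∀ e → e ∉ ground M → lookup ε e ≡ false) ×
    IsTope M (signOf (ground M) ε) ×
    All (λ F → pS F (signOf (ground M) ε) ∈ᴸ cov M) σ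

  phase : RawOM n → PhaseStr
  phase M = phaseLF (deleteSet M (loops M))

  -- p_i^*(σ): facets of Σ_{M∖i} → facets of Σ_M  (chains in M/L)
  pStar : RawOM n → Fin n → List (Subset n) → List (Subset n)
  pStar M i σ =
    if isColoop M i
    then ⁅ i ⁆ ∷ List.map (λ F → F ∪ ⁅ i ⁆) σ
    else List.map (λ F → cl M F ─ loops M) σ

  -- p^⋄_{cl(i)}(σ): facets of Σ_{M/i} → facets of Σ_M  (chains in M/L)
  pDiamond : RawOM n → Fin n → List (Subset n) → List (Subset n)
  pDiamond M i σ =
    (if isLoop M i then [] else [ ci ]) ++ List.map (λ F → F ∪ ci) σ
    where ci = cl M ⁅ i ⁆ ─ loops M

  deletePhase : RawOM n → Fin n → PhaseStr → PhaseStr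
  deletePhase M i 𝓔 σ ε =
    Σ (Vec Bool n) λ δ → 𝓔 (pStar M i σ) δ × ε ≡ pB ⁅ i ⁆ δ

  contractPhase : RawOM n → Fin n → PhaseStr → PhaseStr
  contractPhase M i 𝓔 σ ε =
    Σ (Vec Bool n) λ δ → 𝓔 (pDiamond M i σ) δ × ε ≡ pB (cl M ⁅ i ⁆) δ

-- A phase δ of 𝓔_M on a chain σ is the same as a covector T = (-1)^δ vanishing
-- exactly on the loops (automatically a tope) with T ∖ F a covector for every F in
-- σ, so both identities are statements about lifting and restricting such topes.
-- Compositions of covectors do the lifting: the composition T₀ of all covectors
-- vanishes exactly on the loops, and that of all covectors vanishing on A vanishes
-- exactly on cl(A).
-- Contraction: a tope S of M/i is a covector of M vanishing exactly on cl(i); it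
-- lifts to S ∘ T₀, and a tope T of M restricts back to T ∖ cl(i).
-- Deletion: a tope of M∖i is p_i(X₀) for a covector X₀ and lifts to Y ∘ X₀ ∘ T₀,
-- where Y fixes the sign at i.  The flats F of σ with i ∉ cl(F) form an initial
-- segment of the chain, and Y is built along it so that every such F has a
-- covector restricting to S ∖ F with that sign at i; the remaining flats are
-- handled by closures.  If i is a coloop, eliminating i against its cocircuit
-- shows that p_i maps covectors to covectors.

module Submission where

open import Defs
open import Data.Bool using (Bool; true; false; if_then_else_; _∧_; _∨_; not)
import Data.Bool as Bool
open import Data.Bool.Properties using (∨-zeroʳ)
open import Data.Empty using (⊥-elim)
open import Data.Fin using (Fin; zero; suc) renaming (_≟_ to _≟ᶠ_)
open import Data.Fin.Subset using (Subset; ⊤; ⁅_⁆; _∩_; _∪_; _─_; _⊆_; _∉_) renaming (⊥ to ∅)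
open import Data.Fin.Subset.Properties using (_⊆?_; _∈?_; ⊆-trans; ⊆-min; x∈⁅x⁆; x∈⁅y⁆⇒x≡y)
open import Data.List using (List; []; _∷_; _++_; filter; foldr)
import Data.List as List
open import Data.List.Membership.Propositional using (find) renaming (_∈_ to _∈ₗ_)
open import Data.List.Membership.Propositional.Properties using (∈-filter⁺; ∈-filter⁻; ∈-map⁺; ∈-map⁻)
open import Data.List.Relation.Unary.All as All using (All; []; _∷_)
import Data.List.Relation.Unary.All.Properties as All
open import Data.List.Relation.Unary.AllPairs using (AllPairs; []; _∷_)
open import Data.List.Relation.Unary.Any using (here; there; any?)
import Data.List.Relation.Unary.Linked as Linked
open import Data.List.Relation.Unary.Linked.Properties using (Linked⇒AllPairs)
open import Data.Nat using (ℕ)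
open import Data.Product using (Σ; _×_; _,_; proj₁; proj₂)
open import Data.Sum using (_⊎_; inj₁; inj₂)
open import Data.Vec using (Vec; []; _∷_; lookup; replicate; tabulate)
open import Data.Vec.Properties
  using (≡-dec; []=⇒lookup; lookup⇒[]=; lookup-replicate; lookup-zipWith; lookup-map;
         tabulate∘lookup; tabulate-cong; lookup∘tabulate)
open import Function using (_∘_)
open import Function.Bundles using (_⇔_; mk⇔)
import Level
open import Relation.Binary using (Rel)
open import Relation.Binary.PropositionalEquality
  using (_≡_; _≢_; refl; sym; trans; cong; cong₂; subst; module ≡-Reasoning)
open import Relation.Nullary using (yes; no; proof; Reflects; invert)
open import Relation.Unary using (Pred; Decidable)

open ≡-Reasoning

private
  variable
    n : ℕ

false≢true : false ≢ true
false≢true ()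

lookup-ext : ∀ {A : Set} {u v : Vec A n} → (∀ e → lookup u e ≡ lookup v e) → u ≡ v
lookup-ext {u = u} {v} p = trans (sym (tabulate∘lookup u)) (trans (tabulate-cong p) (tabulate∘lookup v))

lookup-⊤ : (e : Fin n) → lookup ⊤ e ≡ true
lookup-⊤ e = lookup-replicate e true

lookup-∅ : (e : Fin n) → lookup ∅ e ≡ false
lookup-∅ e = lookup-replicate e false

lookup-⁅x⁆-x : (i : Fin n) → lookup ⁅ i ⁆ i ≡ true
lookup-⁅x⁆-x zero = refl
lookup-⁅x⁆-x (suc i) = lookup-⁅x⁆-x i

lookup-⁅x⁆-y : (i e : Fin n) → i ≢ e → lookup ⁅ i ⁆ e ≡ false
lookup-⁅x⁆-y zero zero i≢e = ⊥-elim (i≢e refl)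
lookup-⁅x⁆-y zero (suc e) _ = lookup-∅ e
lookup-⁅x⁆-y (suc i) zero _ = refl
lookup-⁅x⁆-y (suc i) (suc e) i≢e = lookup-⁅x⁆-y i e (λ i≡e → i≢e (cong suc i≡e))

lookup-⁅x⁆⇒≡ : (i e : Fin n) → lookup ⁅ i ⁆ e ≡ true → i ≡ e
lookup-⁅x⁆⇒≡ i e p with i ≟ᶠ e
... | yes i≡e = i≡e
... | no i≢e with () ← trans (sym p) (lookup-⁅x⁆-y i e i≢e)

lookup-∩ : ∀ (p q : Subset n) e → lookup (p ∩ q) e ≡ (lookup p e ∧ lookup q e)
lookup-∩ p q e = lookup-zipWith _∧_ e p q

lookup-∪ : ∀ (p q : Subset n) e → lookup (p ∪ q) e ≡ (lookup p e ∨ lookup q e)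
lookup-∪ p q e = lookup-zipWith _∨_ e p q

lookup-─-true : ∀ (p q : Subset n) e → lookup q e ≡ true → lookup (p ─ q) e ≡ false
lookup-─-true (_ ∷ p) (true ∷ q) zero _ = refl
lookup-─-true (_ ∷ p) (_ ∷ q) (suc e) r = lookup-─-true p q e r

lookup-─-false : ∀ (p q : Subset n) e → lookup q e ≡ false → lookup (p ─ q) e ≡ lookup p e
lookup-─-false (_ ∷ p) (false ∷ q) zero _ = refl
lookup-─-false (_ ∷ p) (_ ∷ q) (suc e) r = lookup-─-false p q e r

lookup-∪-⁅x⁆-x : (F : Subset n) (i : Fin n) → lookup (F ∪ ⁅ i ⁆) i ≡ true
lookup-∪-⁅x⁆-x F i rewrite lookup-∪ F ⁅ i ⁆ i | lookup-⁅x⁆-x i = ∨-zeroʳ (lookup F i)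

lookup-⊤─ : ∀ (p : Subset n) e → lookup (⊤ ─ p) e ≡ not (lookup p e)
lookup-⊤─ p e with lookup p e in r
... | true = lookup-─-true ⊤ p e r
... | false = trans (lookup-─-false ⊤ p e r) (lookup-⊤ e)

lookup-⁅x⁆-false⇒≢ : (i e : Fin n) → lookup ⁅ i ⁆ e ≡ false → i ≢ e
lookup-⁅x⁆-false⇒≢ i e r refl = false≢true (trans (sym r) (lookup-⁅x⁆-x i))

⊤─⁅x⁆-x : (i : Fin n) → lookup (⊤ ─ ⁅ i ⁆) i ≡ false
⊤─⁅x⁆-x i = lookup-─-true ⊤ ⁅ i ⁆ i (lookup-⁅x⁆-x i)

⊤─⁅x⁆-y : (i e : Fin n) → i ≢ e → lookup (⊤ ─ ⁅ i ⁆) e ≡ true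
⊤─⁅x⁆-y i e i≢e = trans (lookup-─-false ⊤ ⁅ i ⁆ e (lookup-⁅x⁆-y i e i≢e)) (lookup-⊤ e)

⊤─⁅x⁆⇒≢ : (i e : Fin n) → lookup (⊤ ─ ⁅ i ⁆) e ≡ true → i ≢ e
⊤─⁅x⁆⇒≢ i e r refl = false≢true (trans (sym (⊤─⁅x⁆-x i)) r)

∧-true⁻ : ∀ {a b} → (a ∧ b) ≡ true → a ≡ true × b ≡ true
∧-true⁻ {true} r = refl , r

∧-true⁺ : ∀ {a b} → a ≡ true → b ≡ true → (a ∧ b) ≡ true
∧-true⁺ refl refl = refl

sign : Bool → Sign
sign b = if b then neg else pos

isNeg : Sign → Bool
isNeg neg = true
isNeg _ = false

sign≢zer : ∀ b → sign b ≢ zer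
sign≢zer true ()
sign≢zer false ()

isNeg-sign : ∀ b → isNeg (sign b) ≡ b
isNeg-sign true = refl
isNeg-sign false = refl

isZero⇒≡zer : ∀ {s} → isZero s ≡ true → s ≡ zer
isZero⇒≡zer {zer} _ = refl

≡zer⇒isZero : ∀ {s} → s ≡ zer → isZero s ≡ true
≡zer⇒isZero refl = refl

-sgn-involutive : ∀ s → -sgn (-sgn s) ≡ s
-sgn-involutive zer = refl
-sgn-involutive pos = refl
-sgn-involutive neg = refl

compS-nonzero : ∀ {a} b → a ≢ zer → compS a b ≡ a
compS-nonzero {zer} b a≢0 = ⊥-elim (a≢0 refl)
compS-nonzero {pos} b _ = refl
compS-nonzero {neg} b _ = refl

compS-zer⁻ : ∀ {a b} → compS a b ≡ zer → a ≡ zer × b ≡ zer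
compS-zer⁻ {zer} r = refl , r

nonzero-signs : ∀ {a b} → a ≢ zer → b ≢ zer → (a ≡ b) ⊎ (a ≡ -sgn b)
nonzero-signs {zer} a≢0 _ = ⊥-elim (a≢0 refl)
nonzero-signs {b = zer} _ b≢0 = ⊥-elim (b≢0 refl)
nonzero-signs {pos} {pos} _ _ = inj₁ refl
nonzero-signs {pos} {neg} _ _ = inj₂ refl
nonzero-signs {neg} {pos} _ _ = inj₂ refl
nonzero-signs {neg} {neg} _ _ = inj₁ refl

compS-idem : ∀ a → compS a a ≡ a
compS-idem zer = refl
compS-idem pos = refl
compS-idem neg = refl

compS-zerʳ : ∀ a → compS a zer ≡ a
compS-zerʳ zer = refl
compS-zerʳ pos = refl
compS-zerʳ neg = refl

lookup-∘ˢ : ∀ (X Y : SignVec n) e → lookup (X ∘ˢ Y) e ≡ compS (lookup X e) (lookup Y e)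
lookup-∘ˢ X Y e = lookup-zipWith compS e X Y

lookup-negV : ∀ (X : SignVec n) e → lookup (negV X) e ≡ -sgn (lookup X e)
lookup-negV X e = lookup-map e -sgn X

lookup-zeroSet : ∀ (M : RawOM n) X e → lookup (zeroSet M X) e ≡ (lookup (ground M) e ∧ isZero (lookup X e))
lookup-zeroSet M X e rewrite lookup-∩ (ground M) (zeros X) e | lookup-map e isZero X = refl

lookup-pS-true : ∀ A (X : SignVec n) e → lookup A e ≡ true → lookup (pS A X) e ≡ zer
lookup-pS-true A X e r rewrite lookup-zipWith (λ a x → if a then zer else x) e A X | r = refl

lookup-pS-false : ∀ A (X : SignVec n) e → lookup A e ≡ false → lookup (pS A X) e ≡ lookup X e
lookup-pS-false A X e r rewrite lookup-zipWith (λ a x → if a then zer else x) e A X | r = refl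

lookup-pS-zer : ∀ A (X : SignVec n) e → lookup X e ≡ zer → lookup (pS A X) e ≡ zer
lookup-pS-zer A X e X≡0 with lookup A e in r
... | true = lookup-pS-true A X e r
... | false = trans (lookup-pS-false A X e r) X≡0

lookup-pB-true : ∀ A (δ : Vec Bool n) e → lookup A e ≡ true → lookup (pB A δ) e ≡ false
lookup-pB-true A δ e r rewrite lookup-zipWith (λ a x → if a then false else x) e A δ | r = refl

lookup-pB-false : ∀ A (δ : Vec Bool n) e → lookup A e ≡ false → lookup (pB A δ) e ≡ lookup δ e
lookup-pB-false A δ e r rewrite lookup-zipWith (λ a x → if a then false else x) e A δ | r = refl

lookup-signOf-true : ∀ G (δ : Vec Bool n) e → lookup G e ≡ true → lookup (signOf G δ) e ≡ sign (lookup δ e)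
lookup-signOf-true G δ e r rewrite lookup-zipWith (λ s b → if s then (if b then neg else pos) else zer) e G δ | r = refl

lookup-signOf-false : ∀ G (δ : Vec Bool n) e → lookup G e ≡ false → lookup (signOf G δ) e ≡ zer
lookup-signOf-false G δ e r rewrite lookup-zipWith (λ s b → if s then (if b then neg else pos) else zer) e G δ | r = refl

signOf-zer⁻ : ∀ G (δ : Vec Bool n) e → lookup (signOf G δ) e ≡ zer → lookup G e ≡ false
signOf-zer⁻ G δ e r with lookup G e in g
... | true = ⊥-elim (sign≢zer (lookup δ e) (trans (sym (lookup-signOf-true G δ e g)) r))
... | false = refl

lookup-pS-⁅x⁆-x : ∀ i (X : SignVec n) → lookup (pS ⁅ i ⁆ X) i ≡ zer
lookup-pS-⁅x⁆-x i X = lookup-pS-true ⁅ i ⁆ X i (lookup-⁅x⁆-x i)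

lookup-pS-⁅x⁆-y : ∀ i (X : SignVec n) e → i ≢ e → lookup (pS ⁅ i ⁆ X) e ≡ lookup X e
lookup-pS-⁅x⁆-y i X e i≢e = lookup-pS-false ⁅ i ⁆ X e (lookup-⁅x⁆-y i e i≢e)

zeroSet⇒zer : ∀ (R : RawOM n) Y e → lookup (zeroSet R Y) e ≡ true → lookup Y e ≡ zer
zeroSet⇒zer R Y e r = isZero⇒≡zer (proj₂ (∧-true⁻ {lookup (ground R) e} (trans (sym (lookup-zeroSet R Y e)) r)))

zer⇒zeroSet : ∀ (R : RawOM n) Y e → lookup (ground R) e ≡ true → lookup Y e ≡ zer → lookup (zeroSet R Y) e ≡ true
zer⇒zeroSet R Y e r Y≡0 = trans (lookup-zeroSet R Y e) (∧-true⁺ r (≡zer⇒isZero Y≡0))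

∉⇒false : ∀ (p : Subset n) e → e ∉ p → lookup p e ≡ false
∉⇒false p e e∉p with lookup p e in r
... | true = ⊥-elim (e∉p (lookup⇒[]= e p r))
... | false = refl

false⇒∉ : ∀ (p : Subset n) e → lookup p e ≡ false → e ∉ p
false⇒∉ p e r e∈p = false≢true (trans (sym r) ([]=⇒lookup e∈p))

ZeroOn : Subset n → SignVec n → Set
ZeroOn A X = ∀ e → lookup A e ≡ true → lookup X e ≡ zer

pS-zeroOn : ∀ A (X : SignVec n) → ZeroOn A X → pS A X ≡ X
pS-zeroOn A X z = lookup-ext pointwise
  where
  pointwise : ∀ e → lookup (pS A X) e ≡ lookup X e
  pointwise e with lookup A e in r
  ... | true = trans (lookup-pS-true A X e r) (sym (z e r))
  ... | false = lookup-pS-false A X e r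

zeroOn-⁅x⁆ : ∀ i (X : SignVec n) → lookup X i ≡ zer → ZeroOn ⁅ i ⁆ X
zeroOn-⁅x⁆ i X Xi≡0 e r = subst (λ a → lookup X a ≡ zer) (lookup-⁅x⁆⇒≡ i e r) Xi≡0

pS-zeroOn-⁅x⁆ : ∀ i (X : SignVec n) → lookup X i ≡ zer → pS ⁅ i ⁆ X ≡ X
pS-zeroOn-⁅x⁆ i X Xi≡0 = pS-zeroOn ⁅ i ⁆ X (zeroOn-⁅x⁆ i X Xi≡0)

pS-∅ : ∀ (X : SignVec n) → pS ∅ X ≡ X
pS-∅ X = pS-zeroOn ∅ X λ e r → ⊥-elim (false≢true (trans (sym (lookup-∅ e)) r))

pS-∪ : ∀ A B (X : SignVec n) → pS (A ∪ B) X ≡ pS A (pS B X)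
pS-∪ A B X = lookup-ext pointwise
  where
  pointwise : ∀ e → lookup (pS (A ∪ B) X) e ≡ lookup (pS A (pS B X)) e
  pointwise e with lookup A e in a | lookup B e in b
  ... | true | _ = trans (lookup-pS-true (A ∪ B) X e (trans (lookup-∪ A B e) (cong (_∨ _) a)))
                         (sym (lookup-pS-true A _ e a))
  ... | false | true = trans (lookup-pS-true (A ∪ B) X e (trans (lookup-∪ A B e) (cong₂ _∨_ a b)))
                             (sym (trans (lookup-pS-false A _ e a) (lookup-pS-true B X e b)))
  ... | false | false = trans (lookup-pS-false (A ∪ B) X e (trans (lookup-∪ A B e) (cong₂ _∨_ a b)))
                              (sym (trans (lookup-pS-false A _ e a) (lookup-pS-false B X e b)))

pS-pS-⁅x⁆ : ∀ F i (X : SignVec n) → pS F (pS ⁅ i ⁆ X) ≡ pS ⁅ i ⁆ (pS (F ∪ ⁅ i ⁆) X)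
pS-pS-⁅x⁆ F i X = begin
  pS F (pS ⁅ i ⁆ X)            ≡⟨ pS-∪ F ⁅ i ⁆ X ⟨
  pS (F ∪ ⁅ i ⁆) X             ≡⟨ pS-zeroOn-⁅x⁆ i _ (lookup-pS-true (F ∪ ⁅ i ⁆) X i (lookup-∪-⁅x⁆-x F i)) ⟨
  pS ⁅ i ⁆ (pS (F ∪ ⁅ i ⁆) X)  ∎

pS-─ : ∀ A B (X : SignVec n) → ZeroOn B X → pS (A ─ B) X ≡ pS A X
pS-─ A B X z = lookup-ext pointwise
  where
  pointwise : ∀ e → lookup (pS (A ─ B) X) e ≡ lookup (pS A X) e
  pointwise e with lookup B e in b
  ... | true = trans (lookup-pS-zer (A ─ B) X e (z e b)) (sym (lookup-pS-zer A X e (z e b)))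
  ... | false with lookup A e in a
  ...   | true = trans (lookup-pS-true (A ─ B) X e (trans (lookup-─-false A B e b) a)) (sym (lookup-pS-true A X e a))
  ...   | false = trans (lookup-pS-false (A ─ B) X e (trans (lookup-─-false A B e b) a)) (sym (lookup-pS-false A X e a))

module _ {A : Set} {P : Pred A Level.zero} (P? : Decidable P) (f : A → Subset n) (g : Subset n) where

  lookup-⋂-filter⁻ : ∀ xs e → lookup (foldr _∩_ g (List.map f (filter P? xs))) e ≡ true →
                     lookup g e ≡ true × (∀ {x} → x ∈ₗ xs → P x → lookup (f x) e ≡ true)
  lookup-⋂-filter⁻ [] e r = r , λ ()
  lookup-⋂-filter⁻ (x ∷ xs) e r with P? x
  ... | no ¬Px = let g∋e , rest = lookup-⋂-filter⁻ xs e r in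
    g∋e , λ { (here refl) Px → ⊥-elim (¬Px Px) ; (there x∈) → rest x∈ }
  ... | yes _ = let fx∋e , r′ = ∧-true⁻ (trans (sym (lookup-∩ (f x) _ e)) r)
                    g∋e , rest = lookup-⋂-filter⁻ xs e r′ in
    g∋e , λ { (here refl) _ → fx∋e ; (there x∈) → rest x∈ }

  lookup-⋂-filter⁺ : ∀ xs e → lookup g e ≡ true → (∀ {x} → x ∈ₗ xs → P x → lookup (f x) e ≡ true) →
                     lookup (foldr _∩_ g (List.map f (filter P? xs))) e ≡ true
  lookup-⋂-filter⁺ [] e g∋e h = g∋e
  lookup-⋂-filter⁺ (x ∷ xs) e g∋e h with P? x
  ... | no _ = lookup-⋂-filter⁺ xs e g∋e (h ∘ there)
  ... | yes Px = trans (lookup-∩ (f x) _ e) (∧-true⁺ (h (here refl) Px) (lookup-⋂-filter⁺ xs e g∋e (h ∘ there)))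

phaseOf : SignVec n → Vec Bool n
phaseOf T = tabulate (λ e → isNeg (lookup T e))

lookup-phaseOf : ∀ (T : SignVec n) e → lookup (phaseOf T) e ≡ isNeg (lookup T e)
lookup-phaseOf T e = lookup∘tabulate (λ e → isNeg (lookup T e)) e

pS-∘ˢ-≼ : ∀ A (Y B : SignVec n) → pS A Y ≼ pS A B → pS A (Y ∘ˢ B) ≡ pS A B
pS-∘ˢ-≼ A Y B Y≼B = lookup-ext pointwise
  where
  pointwise : ∀ e → lookup (pS A (Y ∘ˢ B)) e ≡ lookup (pS A B) e
  pointwise e with lookup A e in r | Y≼B e
  ... | true | _ = trans (lookup-pS-true A _ e r) (sym (lookup-pS-true A B e r))
  ... | false | Y≼B-e
    rewrite lookup-pS-false A (Y ∘ˢ B) e r | lookup-∘ˢ Y B e | lookup-pS-false A Y e r | lookup-pS-false A B e r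
    = absorbed Y≼B-e
    where
    absorbed : ∀ {y b} → (y ≡ zer) ⊎ (y ≡ b) → compS y b ≡ b
    absorbed (inj₁ refl) = refl
    absorbed {b = b} (inj₂ refl) = compS-idem b

pS-antitone : ∀ {F G : Subset n} (X : SignVec n) → F ⊆ G → pS G X ≼ pS F X
pS-antitone {F = F} {G} X F⊆G e with lookup G e in g
... | true = inj₁ (lookup-pS-true G X e g)
... | false = inj₂ (trans (lookup-pS-false G X e g) (sym (lookup-pS-false F X e F∌e)))
  where
  F∌e : lookup F e ≡ false
  F∌e with lookup F e in f
  ... | true = ⊥-elim (false≢true (trans (sym g) ([]=⇒lookup (F⊆G (lookup⇒[]= e F f)))))
  ... | false = refl

pS-∘ˢ-absorb : ∀ A (Y Z W : SignVec n) → pS A Y ≡ W →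
               (∀ e → lookup A e ≡ false → lookup W e ≡ zer → lookup Z e ≡ zer) →
               pS A (Y ∘ˢ Z) ≡ W
pS-∘ˢ-absorb A Y Z W refl absorbs = lookup-ext pointwise
  where
  pointwise : ∀ e → lookup (pS A (Y ∘ˢ Z)) e ≡ lookup (pS A Y) e
  pointwise e with lookup A e in a
  ... | true = trans (lookup-pS-true A _ e a) (sym (lookup-pS-true A Y e a))
  ... | false rewrite lookup-pS-false A (Y ∘ˢ Z) e a | lookup-pS-false A Y e a | lookup-∘ˢ Y Z e
    with lookup Y e in y
  ...   | zer = absorbs e a (trans (lookup-pS-false A Y e a) y)
  ...   | pos = refl
  ...   | neg = refl

≼-zeros⇒≡ : ∀ (S Y : SignVec n) → (∀ e → lookup S e ≡ zer → lookup Y e ≡ zer) → S ≼ Y → Y ≡ S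
≼-zeros⇒≡ S Y zeros⊆ S≼Y = lookup-ext λ e → pointwise e (S≼Y e)
  where
  pointwise : ∀ e → (lookup S e ≡ zer) ⊎ (lookup S e ≡ lookup Y e) → lookup Y e ≡ lookup S e
  pointwise e (inj₁ S≡0) = trans (zeros⊆ e S≡0) (sym S≡0)
  pointwise e (inj₂ S≡Y) = sym S≡Y

pB-phaseOf : ∀ A G (ε : Vec Bool n) T → (∀ e → lookup G e ≡ false → lookup ε e ≡ false) →
             (∀ e → lookup A e ≡ true → lookup G e ≡ false) → pS A T ≡ signOf G ε → pB A (phaseOf T) ≡ ε
pB-phaseOf A G ε T vanishes A∩G≡∅ T≡S = lookup-ext pointwise
  where
  pointwise : ∀ e → lookup (pB A (phaseOf T)) e ≡ lookup ε e
  pointwise e with lookup A e in a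
  ... | true = trans (lookup-pB-true A _ e a) (sym (vanishes e (A∩G≡∅ e a)))
  ... | false rewrite lookup-pB-false A (phaseOf T) e a | lookup-phaseOf T e
                    | sym (lookup-pS-false A T e a) | T≡S with lookup G e in g
  ...   | true = trans (cong isNeg (lookup-signOf-true G ε e g)) (isNeg-sign (lookup ε e))
  ...   | false = trans (cong isNeg (lookup-signOf-false G ε e g)) (sym (vanishes e g))

signOf-pB : ∀ A G G₀ (δ : Vec Bool n) → (∀ e → lookup A e ≡ true → lookup G e ≡ false) →
            (∀ e → lookup A e ≡ false → lookup G e ≡ lookup G₀ e) → signOf G (pB A δ) ≡ pS A (signOf G₀ δ)
signOf-pB A G G₀ δ A∩G≡∅ G≡G₀ = lookup-ext pointwise
  where
  pointwise : ∀ e → lookup (signOf G (pB A δ)) e ≡ lookup (pS A (signOf G₀ δ)) e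
  pointwise e with lookup A e in a
  ... | true = trans (lookup-signOf-false G _ e (A∩G≡∅ e a)) (sym (lookup-pS-true A _ e a))
  ... | false rewrite lookup-pS-false A (signOf G₀ δ) e a with lookup G e in g
  ...   | true = trans (lookup-signOf-true G _ e g)
                   (trans (cong sign (lookup-pB-false A δ e a)) (sym (lookup-signOf-true G₀ δ e (trans (sym (G≡G₀ e a)) g))))
  ...   | false = trans (lookup-signOf-false G _ e g) (sym (lookup-signOf-false G₀ δ e (trans (sym (G≡G₀ e a)) g)))

AllPairs-++⁻ˡ : ∀ {A : Set} {R : Rel A Level.zero} xs {ys} → AllPairs R (xs ++ ys) → AllPairs R xs
AllPairs-++⁻ˡ [] _ = []
AllPairs-++⁻ˡ (x ∷ xs) (px ∷ pxs) = All.++⁻ˡ xs px ∷ AllPairs-++⁻ˡ xs pxs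

-- Closures, loops and topes

composeAll : List (SignVec n) → SignVec n
composeAll [] = replicate _ zer
composeAll (X ∷ Xs) = X ∘ˢ composeAll Xs

composeAll-zer⁻ : ∀ (Xs : List (SignVec n)) e → lookup (composeAll Xs) e ≡ zer → ∀ {X} → X ∈ᴸ Xs → lookup X e ≡ zer
composeAll-zer⁻ (X ∷ Xs) e r {Y} Y∈ with compS-zer⁻ {lookup X e} (trans (sym (lookup-∘ˢ X (composeAll Xs) e)) r)
composeAll-zer⁻ (X ∷ Xs) e r (here refl) | X≡0 , _ = X≡0
composeAll-zer⁻ (X ∷ Xs) e r (there Y∈) | _ , rest≡0 = composeAll-zer⁻ Xs e rest≡0 Y∈

composeAll-zer⁺ : ∀ (Xs : List (SignVec n)) e → (∀ {X} → X ∈ᴸ Xs → lookup X e ≡ zer) → lookup (composeAll Xs) e ≡ zer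
composeAll-zer⁺ [] e _ = lookup-replicate e zer
composeAll-zer⁺ (X ∷ Xs) e h
  rewrite lookup-∘ˢ X (composeAll Xs) e | h (here refl) = composeAll-zer⁺ Xs e (h ∘ there)

module OrientedMatroid {n} (C : List (SignVec n)) (om : IsOrientedMatroid (mkOM ⊤ C)) where
  open IsOrientedMatroid om public

  M : RawOM n
  M = mkOM ⊤ C

  L : Subset n
  L = loops M

  composeAll-∈ : ∀ {Xs} → (∀ {X} → X ∈ᴸ Xs → X ∈ᴸ C) → composeAll Xs ∈ᴸ C
  composeAll-∈ {[]} _ = cov-zero
  composeAll-∈ {X ∷ Xs} h = cov-comp (h (here refl)) (composeAll-∈ (h ∘ there))

  zeroOn⇒⊆zeroSet : ∀ A X → ZeroOn A X → A ⊆ zeroSet M X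
  zeroOn⇒⊆zeroSet A X z {e} e∈A = lookup⇒[]= e _
    (trans (lookup-zeroSet M X e) (∧-true⁺ (lookup-⊤ e) (≡zer⇒isZero (z e ([]=⇒lookup e∈A)))))

  ⊆zeroSet⇒zeroOn : ∀ A X → A ⊆ zeroSet M X → ZeroOn A X
  ⊆zeroSet⇒zeroOn A X A⊆ e r =
    isZero⇒≡zer (proj₂ (∧-true⁻ (trans (sym (lookup-zeroSet M X e)) ([]=⇒lookup (A⊆ (lookup⇒[]= e A r))))))

  ∈cl⁻ : ∀ A e → lookup (cl M A) e ≡ true → ∀ {X} → X ∈ᴸ C → ZeroOn A X → lookup X e ≡ zer
  ∈cl⁻ A e r {X} X∈ z = isZero⇒≡zer (proj₂ (∧-true⁻ (trans (sym (lookup-zeroSet M X e))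
    (proj₂ (lookup-⋂-filter⁻ (λ X → A ⊆? zeroSet M X) (zeroSet M) ⊤ C e r) X∈ (zeroOn⇒⊆zeroSet A X z)))))

  ∈cl⁺ : ∀ A e → (∀ {X} → X ∈ᴸ C → ZeroOn A X → lookup X e ≡ zer) → lookup (cl M A) e ≡ true
  ∈cl⁺ A e h = lookup-⋂-filter⁺ (λ X → A ⊆? zeroSet M X) (zeroSet M) ⊤ C e (lookup-⊤ e)
    λ {X} X∈ A⊆ → trans (lookup-zeroSet M X e) (∧-true⁺ (lookup-⊤ e) (≡zer⇒isZero (h X∈ (⊆zeroSet⇒zeroOn A X A⊆))))

  cl-extensive : ∀ A e → lookup A e ≡ true → lookup (cl M A) e ≡ true
  cl-extensive A e r = ∈cl⁺ A e (λ _ z → z e r)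

  ∈loops⁻ : ∀ e → lookup L e ≡ true → ∀ {X} → X ∈ᴸ C → lookup X e ≡ zer
  ∈loops⁻ e r X∈ = ∈cl⁻ ∅ e r X∈ (λ a ∅∋a → ⊥-elim (false≢true (trans (sym (lookup-∅ a)) ∅∋a)))

  ∈loops⁺ : ∀ e → (∀ {X} → X ∈ᴸ C → lookup X e ≡ zer) → lookup L e ≡ true
  ∈loops⁺ e h = ∈cl⁺ ∅ e (λ X∈ _ → h X∈)

  loops⊆cl : ∀ A e → lookup L e ≡ true → lookup (cl M A) e ≡ true
  loops⊆cl A e r = ∈cl⁺ A e (λ X∈ _ → ∈loops⁻ e r X∈)

  loopsOn : ∀ {X} → X ∈ᴸ C → ZeroOn L X
  loopsOn X∈ e r = ∈loops⁻ e r X∈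

  closureCovector : Subset n → SignVec n
  closureCovector A = composeAll (filter (λ X → A ⊆? zeroSet M X) C)

  closureCovector-∈ : ∀ A → closureCovector A ∈ᴸ C
  closureCovector-∈ A = composeAll-∈ (λ X∈ → proj₁ (∈-filter⁻ (λ X → A ⊆? zeroSet M X) X∈))

  closureCovector-zeroOn : ∀ A → ZeroOn A (closureCovector A)
  closureCovector-zeroOn A a r = composeAll-zer⁺ _ a λ {X} X∈ →
    ⊆zeroSet⇒zeroOn A X (proj₂ (∈-filter⁻ (λ X → A ⊆? zeroSet M X) {xs = C} X∈)) a r

  closureCovector-zer : ∀ A e → lookup (closureCovector A) e ≡ zer → lookup (cl M A) e ≡ true
  closureCovector-zer A e r = ∈cl⁺ A e λ {X} X∈ z →
    composeAll-zer⁻ _ e r (∈-filter⁺ (λ X → A ⊆? zeroSet M X) X∈ (zeroOn⇒⊆zeroSet A X z))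

  Full : SignVec n → Set
  Full T = ∀ e → lookup T e ≡ zer → lookup L e ≡ true

  fullCovector : SignVec n
  fullCovector = closureCovector ∅

  fullCovector-∈ : fullCovector ∈ᴸ C
  fullCovector-∈ = closureCovector-∈ ∅

  fullCovector-full : Full fullCovector
  fullCovector-full = closureCovector-zer ∅

  full-∘ˢ : ∀ X {Y} → Full Y → Full (X ∘ˢ Y)
  full-∘ˢ X {Y} full e r = full e (proj₂ (compS-zer⁻ {lookup X e} (trans (sym (lookup-∘ˢ X Y e)) r)))

  ∈deleteLoops⁻ : ∀ {Y} → Y ∈ᴸ cov (deleteSet M L) → Y ∈ᴸ C
  ∈deleteLoops⁻ Y∈ with ∈-map⁻ (pS L) Y∈
  ... | X , X∈ , refl = subst (_∈ᴸ C) (sym (pS-zeroOn L X (loopsOn X∈))) X∈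

  ∈deleteLoops⁺ : ∀ {X} → X ∈ᴸ C → X ∈ᴸ cov (deleteSet M L)
  ∈deleteLoops⁺ {X} X∈ = subst (_∈ᴸ cov (deleteSet M L)) (pS-zeroOn L X (loopsOn X∈)) (∈-map⁺ (pS L) X∈)

  -- (-1)^δ on the ground set E ∖ L of M ∖ L, the encoding used by `phase`.
  topeOf : Vec Bool n → SignVec n
  topeOf = signOf (⊤ ─ L)

  lookup-topeOf : ∀ δ e → lookup L e ≡ false → lookup (topeOf δ) e ≡ sign (lookup δ e)
  lookup-topeOf δ e r = lookup-signOf-true (⊤ ─ L) δ e (trans (lookup-─-false ⊤ L e r) (lookup-⊤ e))

  topeOf-phaseOf : ∀ {T} → T ∈ᴸ C → Full T → topeOf (phaseOf T) ≡ T
  topeOf-phaseOf {T} T∈ full = lookup-ext pointwise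
    where
    pointwise : ∀ e → lookup (topeOf (phaseOf T)) e ≡ lookup T e
    pointwise e with lookup L e in r
    ... | true = trans (lookup-signOf-false (⊤ ─ L) _ e (lookup-─-true ⊤ L e r)) (sym (loopsOn T∈ e r))
    ... | false rewrite lookup-topeOf (phaseOf T) e r | lookup-phaseOf T e
      with lookup T e in t
    ...   | zer = ⊥-elim (false≢true (trans (sym r) (full e t)))
    ...   | pos = refl
    ...   | neg = refl

  full⇒tope : ∀ {T} → T ∈ᴸ C → Full T → IsTope (deleteSet M L) T
  full⇒tope {T} T∈ full = ∈deleteLoops⁺ T∈ , λ Y Y∈ T≼Y → lookup-ext λ e → above Y (∈deleteLoops⁻ Y∈) e (T≼Y e)
    where
    above : ∀ Y → Y ∈ᴸ C → ∀ e → (lookup T e ≡ zer) ⊎ (lookup T e ≡ lookup Y e) → lookup Y e ≡ lookup T e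
    above Y Y∈ e (inj₁ T≡0) = trans (∈loops⁻ e (full e T≡0) Y∈) (sym T≡0)
    above Y Y∈ e (inj₂ T≡Y) = sym T≡Y

  phase-intro : ∀ σ {T} → T ∈ᴸ C → Full T → All (λ F → pS F T ∈ᴸ C) σ → phase M σ (phaseOf T)
  phase-intro σ {T} T∈ full chain rewrite topeOf-phaseOf T∈ full =
    vanishes , full⇒tope T∈ full , All.map ∈deleteLoops⁺ chain
    where
    vanishes : ∀ e → e ∉ ground (deleteSet M L) → lookup (phaseOf T) e ≡ false
    vanishes e e∉ with lookup L e in r
    ... | false = ⊥-elim (e∉ (lookup⇒[]= e _ (trans (lookup-─-false ⊤ L e r) (lookup-⊤ e))))
    ... | true = trans (lookup-phaseOf T e) (cong isNeg (loopsOn T∈ e r))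

  record Phase (σ : List (Subset n)) (δ : Vec Bool n) : Set where
    field
      tope-∈ : topeOf δ ∈ᴸ C
      vanishes-on-loops : ∀ e → lookup L e ≡ true → lookup δ e ≡ false
      chain-∈ : All (λ F → pS F (topeOf δ) ∈ᴸ C) σ

  phase-elim : ∀ σ δ → phase M σ δ → Phase σ δ
  phase-elim σ δ (vanishes , (T∈ , _) , chain) = record
    { tope-∈ = ∈deleteLoops⁻ T∈
    ; vanishes-on-loops = λ e r → vanishes e (false⇒∉ (⊤ ─ L) e (lookup-─-true ⊤ L e r))
    ; chain-∈ = All.map ∈deleteLoops⁻ chain
    }

-- Minors by one element

-- Instantiated with Lifts X = X ∈ 𝓒 for M ∖ i and with Lifts X = (X ∈ 𝓒 × X_i = 0) for M / i.
module SingleElementMinor {n} (i : Fin n) (cs : List (SignVec n)) (Lifts : SignVec n → Set)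
  (∈cs⁻ : ∀ {Y} → Y ∈ᴸ cs → Σ (SignVec n) λ X → Lifts X × Y ≡ pS ⁅ i ⁆ X)
  (∈cs⁺ : ∀ {X} → Lifts X → pS ⁅ i ⁆ X ∈ᴸ cs) where

  R : RawOM n
  R = mkOM (⊤ ─ ⁅ i ⁆) cs

  loops⁻ : ∀ e → lookup (loops R) e ≡ true → i ≢ e × (∀ {X} → Lifts X → lookup X e ≡ zer)
  loops⁻ e r with lookup-⋂-filter⁻ (λ Y → ∅ ⊆? zeroSet R Y) (zeroSet R) (⊤ ─ ⁅ i ⁆) cs e r
  ... | ground∋e , zero-on-cs = i≢e , λ {X} lifts →
      trans (sym (lookup-pS-⁅x⁆-y i X e i≢e)) (zeroSet⇒zer R _ e (zero-on-cs (∈cs⁺ lifts) (⊆-min _)))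
    where
    i≢e = ⊤─⁅x⁆⇒≢ i e ground∋e

  loops⁺ : ∀ e → i ≢ e → (∀ {X} → Lifts X → lookup X e ≡ zer) → lookup (loops R) e ≡ true
  loops⁺ e i≢e h = lookup-⋂-filter⁺ (λ Y → ∅ ⊆? zeroSet R Y) (zeroSet R) (⊤ ─ ⁅ i ⁆) cs e (⊤─⁅x⁆-y i e i≢e)
    λ Y∈ _ → zeroOfLift (∈cs⁻ Y∈)
    where
    zeroOfLift : ∀ {Y} → (Σ (SignVec n) λ X → Lifts X × Y ≡ pS ⁅ i ⁆ X) → lookup (zeroSet R Y) e ≡ true
    zeroOfLift (X , lifts , refl) =
      zer⇒zeroSet R _ e (⊤─⁅x⁆-y i e i≢e) (trans (lookup-pS-⁅x⁆-y i X e i≢e) (h lifts))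

  R∖loops : RawOM n
  R∖loops = deleteSet R (loops R)

  pS-loops-lift : ∀ {X} → Lifts X → pS (loops R) (pS ⁅ i ⁆ X) ≡ pS ⁅ i ⁆ X
  pS-loops-lift {X} lifts = pS-zeroOn (loops R) _ λ e r →
    trans (lookup-pS-⁅x⁆-y i X e (proj₁ (loops⁻ e r))) (proj₂ (loops⁻ e r) lifts)

  ∈cov⁻ : ∀ {Y} → Y ∈ᴸ cov R∖loops → Σ (SignVec n) λ X → Lifts X × Y ≡ pS ⁅ i ⁆ X
  ∈cov⁻ Y∈ with ∈-map⁻ (pS (loops R)) Y∈
  ... | Y₀ , Y₀∈ , refl with ∈cs⁻ Y₀∈
  ... | X , lifts , refl = X , lifts , pS-loops-lift lifts

  ∈cov⁺ : ∀ {X} → Lifts X → pS ⁅ i ⁆ X ∈ᴸ cov R∖loops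
  ∈cov⁺ lifts = subst (_∈ᴸ cov R∖loops) (pS-loops-lift lifts) (∈-map⁺ (pS (loops R)) (∈cs⁺ lifts))

  ∈cov-contract-loops⁻ : ∀ {Y} → Y ∈ᴸ cov (contractSet R (loops R)) → Σ (SignVec n) λ X → Lifts X × Y ≡ pS ⁅ i ⁆ X
  ∈cov-contract-loops⁻ Y∈ with ∈-map⁻ (pS (loops R)) Y∈
  ... | Y₀ , Y₀∈ , refl with ∈cs⁻ (proj₁ (∈-filter⁻ (λ X → loops R ⊆? zeros X) Y₀∈))
  ... | X , lifts , refl = X , lifts , pS-loops-lift lifts

  ground-x : lookup (ground R∖loops) i ≡ false
  ground-x with lookup (loops R) i in r
  ... | true = lookup-─-true (⊤ ─ ⁅ i ⁆) (loops R) i r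
  ... | false = trans (lookup-─-false (⊤ ─ ⁅ i ⁆) (loops R) i r) (⊤─⁅x⁆-x i)

  ground-loop : ∀ e → lookup (loops R) e ≡ true → lookup (ground R∖loops) e ≡ false
  ground-loop e = lookup-─-true (⊤ ─ ⁅ i ⁆) (loops R) e

  ground-nonloop : ∀ e → i ≢ e → lookup (loops R) e ≡ false → lookup (ground R∖loops) e ≡ true
  ground-nonloop e i≢e r = trans (lookup-─-false (⊤ ─ ⁅ i ⁆) (loops R) e r) (⊤─⁅x⁆-y i e i≢e)

-- Contraction

module Contraction {n} (C : List (SignVec n)) (om : IsOrientedMatroid (mkOM ⊤ C)) (i : Fin n) where
  open OrientedMatroid C om

  K : Subset n
  K = cl M ⁅ i ⁆

  ∈K⁻ : ∀ e → lookup K e ≡ true → ∀ {X} → X ∈ᴸ C → lookup X i ≡ zer → lookup X e ≡ zer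
  ∈K⁻ e r {X} X∈ Xi≡0 = ∈cl⁻ ⁅ i ⁆ e r X∈ (zeroOn-⁅x⁆ i X Xi≡0)

  ∈K⁺ : ∀ e → (∀ {X} → X ∈ᴸ C → lookup X i ≡ zer → lookup X e ≡ zer) → lookup K e ≡ true
  ∈K⁺ e h = ∈cl⁺ ⁅ i ⁆ e λ X∈ z → h X∈ (z i (lookup-⁅x⁆-x i))

  i∈K : lookup K i ≡ true
  i∈K = cl-extensive ⁅ i ⁆ i (lookup-⁅x⁆-x i)

  loops⊆K : ∀ e → lookup L e ≡ true → lookup K e ≡ true
  loops⊆K = loops⊆cl ⁅ i ⁆

  Lifts : SignVec n → Set
  Lifts X = X ∈ᴸ C × lookup X i ≡ zer

  ∈cov-contract⁻ : ∀ {Y} → Y ∈ᴸ cov (M /ₘ i) → Σ (SignVec n) λ X → Lifts X × Y ≡ pS ⁅ i ⁆ X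
  ∈cov-contract⁻ Y∈ with ∈-map⁻ (pS ⁅ i ⁆) Y∈
  ... | X , X∈ , refl with ∈-filter⁻ (λ X → ⁅ i ⁆ ⊆? zeros X) X∈
  ... | X∈C , i∈zeros =
    X , (X∈C , isZero⇒≡zer (trans (sym (lookup-map i isZero X)) ([]=⇒lookup (i∈zeros (x∈⁅x⁆ i))))) , refl

  ∈cov-contract⁺ : ∀ {X} → Lifts X → pS ⁅ i ⁆ X ∈ᴸ cov (M /ₘ i)
  ∈cov-contract⁺ {X} (X∈ , Xi≡0) = ∈-map⁺ (pS ⁅ i ⁆) (∈-filter⁺ (λ X → ⁅ i ⁆ ⊆? zeros X) X∈ i∈zeros)
    where
    i∈zeros : ⁅ i ⁆ ⊆ zeros X
    i∈zeros e∈ with refl ← x∈⁅y⁆⇒x≡y i e∈ = lookup⇒[]= i _ (trans (lookup-map i isZero X) (≡zer⇒isZero Xi≡0))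

  open SingleElementMinor i (cov (M /ₘ i)) Lifts ∈cov-contract⁻ ∈cov-contract⁺

  ground-contract : ∀ e → lookup (ground R∖loops) e ≡ not (lookup K e)
  ground-contract e with i ≟ᶠ e
  ... | yes refl = trans ground-x (cong not (sym i∈K))
  ... | no i≢e with lookup K e in k
  ...   | true = ground-loop e (loops⁺ e i≢e λ (X∈ , Xi≡0) → ∈K⁻ e k X∈ Xi≡0)
  ...   | false with lookup (loops R) e in l
  ...     | true = ⊥-elim (false≢true (trans (sym k) (∈K⁺ e λ X∈ Xi≡0 → proj₂ (loops⁻ e l) (X∈ , Xi≡0))))
  ...     | false = ground-nonloop e i≢e l

  ∈cov-contract∖loops⁻ : ∀ {Y} → Y ∈ᴸ cov R∖loops → Lifts Y
  ∈cov-contract∖loops⁻ Y∈ with ∈cov⁻ Y∈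
  ... | X , (X∈ , Xi≡0) , refl rewrite pS-zeroOn-⁅x⁆ i X Xi≡0 = X∈ , Xi≡0

  ∈cov-contract∖loops⁺ : ∀ {X} → Lifts X → X ∈ᴸ cov R∖loops
  ∈cov-contract∖loops⁺ {X} (X∈ , Xi≡0) = subst (_∈ᴸ cov R∖loops) (pS-zeroOn-⁅x⁆ i X Xi≡0) (∈cov⁺ (X∈ , Xi≡0))

  ground-K-true : ∀ e → lookup K e ≡ true → lookup (ground R∖loops) e ≡ false
  ground-K-true e k = trans (ground-contract e) (cong not k)

  ground-K-false : ∀ e → lookup K e ≡ false → lookup (ground R∖loops) e ≡ true
  ground-K-false e k = trans (ground-contract e) (cong not k)

  signOf-ground-zeroOn : ∀ ε → ZeroOn K (signOf (ground R∖loops) ε)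
  signOf-ground-zeroOn ε e k = lookup-signOf-false (ground R∖loops) ε e (ground-K-true e k)

  signOf-ground-zer⇒K : ∀ ε e → lookup (signOf (ground R∖loops) ε) e ≡ zer → lookup K e ≡ true
  signOf-ground-zer⇒K ε e S≡0 with lookup K e in k
  ... | true = refl
  ... | false = ⊥-elim (false≢true (trans (sym (signOf-zer⁻ (ground R∖loops) ε e S≡0)) (ground-K-false e k)))

  pS-∪-K∖loops : ∀ F {T} → T ∈ᴸ C → pS (F ∪ (K ─ L)) T ≡ pS F (pS K T)
  pS-∪-K∖loops F {T} T∈ = trans (pS-∪ F (K ─ L) T) (cong (pS F) (pS-─ K L T (loopsOn T∈)))

  chain-∪-K∖loops⁺ : ∀ σ {T} → T ∈ᴸ C → All (λ F → pS F (pS K T) ∈ᴸ C) σ →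
                     All (λ F → pS F T ∈ᴸ C) (List.map (λ F → F ∪ (K ─ L)) σ)
  chain-∪-K∖loops⁺ σ T∈ chain = All.map⁺ (All.map (subst (_∈ᴸ C) (sym (pS-∪-K∖loops _ T∈))) chain)

  chain-∪-K∖loops⁻ : ∀ σ {T} → T ∈ᴸ C → All (λ F → pS F T ∈ᴸ C) (List.map (λ F → F ∪ (K ─ L)) σ) →
                     All (λ F → pS F (pS K T) ∈ᴸ C) σ
  chain-∪-K∖loops⁻ σ T∈ chain = All.map (subst (_∈ᴸ C) (pS-∪-K∖loops _ T∈)) (All.map⁻ chain)

  chain-pDiamond⁺ : ∀ σ {T} → T ∈ᴸ C → pS K T ∈ᴸ C → All (λ F → pS F (pS K T) ∈ᴸ C) σ →
                    All (λ F → pS F T ∈ᴸ C) (pDiamond M i σ)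
  chain-pDiamond⁺ σ {T} T∈ K∈ chain with i ∈? loops M
  ... | yes _ = chain-∪-K∖loops⁺ σ T∈ chain
  ... | no _ = subst (_∈ᴸ C) (sym (pS-─ K L T (loopsOn T∈))) K∈ ∷ chain-∪-K∖loops⁺ σ T∈ chain

  chain-pDiamond⁻ : ∀ σ {T} → T ∈ᴸ C → All (λ F → pS F T ∈ᴸ C) (pDiamond M i σ) →
                    pS K T ∈ᴸ C × All (λ F → pS F (pS K T) ∈ᴸ C) σ
  chain-pDiamond⁻ σ {T} T∈ chain with i ∈? loops M
  ... | yes i∈L = subst (_∈ᴸ C) (sym (pS-zeroOn K T K⊆zeros)) T∈ , chain-∪-K∖loops⁻ σ T∈ chain
    where
    K⊆zeros : ZeroOn K T
    K⊆zeros e k = ∈K⁻ e k T∈ (loopsOn T∈ i ([]=⇒lookup i∈L))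
  ... | no _ with chain
  ...   | K∖L∈ ∷ chain′ = subst (_∈ᴸ C) (pS-─ K L T (loopsOn T∈)) K∖L∈ , chain-∪-K∖loops⁻ σ T∈ chain′

  contract⇒ : ∀ σ ε → phase (M /ₘ i) σ ε → contractPhase M i (phase M) σ ε
  contract⇒ σ ε (vanishes , (S∈ , _) , chain) =
    phaseOf T , phase-intro (pDiamond M i σ) T∈ (full-∘ˢ S fullCovector-full) chainT , sym ε≡
    where
    S = signOf (ground R∖loops) ε
    S∈C : S ∈ᴸ C
    S∈C = proj₁ (∈cov-contract∖loops⁻ S∈)
    T = S ∘ˢ fullCovector
    T∈ : T ∈ᴸ C
    T∈ = cov-comp S∈C fullCovector-∈
    pS-K-T : pS K T ≡ S
    pS-K-T = pS-∘ˢ-absorb K S fullCovector S (pS-zeroOn K S (signOf-ground-zeroOn ε))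
               (λ e k S≡0 → ⊥-elim (false≢true (trans (sym k) (signOf-ground-zer⇒K ε e S≡0))))
    chainT : All (λ F → pS F T ∈ᴸ C) (pDiamond M i σ)
    chainT = chain-pDiamond⁺ σ T∈ (subst (_∈ᴸ C) (sym pS-K-T) S∈C)
      (All.map (λ p → subst (_∈ᴸ C) (cong (pS _) (sym pS-K-T)) (proj₁ (∈cov-contract∖loops⁻ p))) chain)
    ε≡ : pB K (phaseOf T) ≡ ε
    ε≡ = pB-phaseOf K (ground R∖loops) ε T (λ e g → vanishes e (false⇒∉ _ e g)) ground-K-true pS-K-T

  contract⇐ : ∀ σ ε → contractPhase M i (phase M) σ ε → phase (M /ₘ i) σ ε
  contract⇐ σ ε (δ , ph , refl) = vanishes , (S∈ , maximal) , chainS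
    where
    open Phase (phase-elim (pDiamond M i σ) δ ph)
    S = signOf (ground R∖loops) (pB K δ)
    S≡ : S ≡ pS K (topeOf δ)
    S≡ = signOf-pB K (ground R∖loops) (⊤ ─ L) δ ground-K-true λ e k →
      trans (ground-K-false e k) (sym (trans (lookup-─-false ⊤ L e (nonloop e k)) (lookup-⊤ e)))
      where
      nonloop : ∀ e → lookup K e ≡ false → lookup L e ≡ false
      nonloop e k with lookup L e in l
      ... | true = ⊥-elim (false≢true (trans (sym k) (loops⊆K e l)))
      ... | false = refl
    K-part = chain-pDiamond⁻ σ tope-∈ chain-∈
    Si≡0 : lookup S i ≡ zer
    Si≡0 = signOf-ground-zeroOn (pB K δ) i i∈K
    S∈ : S ∈ᴸ cov R∖loops
    S∈ = ∈cov-contract∖loops⁺ (subst (_∈ᴸ C) (sym S≡) (proj₁ K-part) , Si≡0)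
    vanishes : ∀ e → e ∉ ground R∖loops → lookup (pB K δ) e ≡ false
    vanishes e e∉ with lookup K e in k
    ... | true = lookup-pB-true K δ e k
    ... | false = ⊥-elim (e∉ (lookup⇒[]= e _ (ground-K-false e k)))
    maximal : ∀ Y → Y ∈ᴸ cov R∖loops → S ≼ Y → Y ≡ S
    maximal Y Y∈ = ≼-zeros⇒≡ S Y λ e S≡0 →
      let Y∈C , Yi≡0 = ∈cov-contract∖loops⁻ Y∈ in ∈K⁻ e (signOf-ground-zer⇒K (pB K δ) e S≡0) Y∈C Yi≡0
    chainS : All (λ F → pS F S ∈ᴸ cov R∖loops) σ
    chainS = All.map (λ {F} p → ∈cov-contract∖loops⁺ (subst (_∈ᴸ C) (cong (pS F) (sym S≡)) p , lookup-pS-zer F S i Si≡0))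
                     (proj₂ K-part)

-- Deletion

module Deletion {n} (C : List (SignVec n)) (om : IsOrientedMatroid (mkOM ⊤ C)) (i : Fin n) where
  open OrientedMatroid C om
  open SingleElementMinor i (cov (M ∖ₘ i)) (_∈ᴸ C) (∈-map⁻ (pS ⁅ i ⁆)) (∈-map⁺ (pS ⁅ i ⁆))

  G : Subset n
  G = ground R∖loops

  loops-delete : ∀ e → i ≢ e → lookup (loops R) e ≡ lookup L e
  loops-delete e i≢e with lookup L e in l
  ... | true = loops⁺ e i≢e (∈loops⁻ e l)
  ... | false with lookup (loops R) e in r
  ...   | true = ⊥-elim (false≢true (trans (sym l) (∈loops⁺ e (proj₂ (loops⁻ e r)))))
  ...   | false = refl

  ground-delete : ∀ e → i ≢ e → lookup G e ≡ not (lookup L e)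
  ground-delete e i≢e with lookup L e in l
  ... | true = ground-loop e (trans (loops-delete e i≢e) l)
  ... | false = ground-nonloop e i≢e (trans (loops-delete e i≢e) l)

  ground⇒≢ : ∀ e → lookup G e ≡ true → i ≢ e
  ground⇒≢ e g refl = false≢true (trans (sym ground-x) g)

  ⁅x⁆∩ground≡∅ : ∀ e → lookup ⁅ i ⁆ e ≡ true → lookup G e ≡ false
  ⁅x⁆∩ground≡∅ e r with refl ← lookup-⁅x⁆⇒≡ i e r = ground-x

  ground-false⇒loop : ∀ e → i ≢ e → lookup G e ≡ false → lookup L e ≡ true
  ground-false⇒loop e i≢e g with lookup L e in l
  ... | true = refl
  ... | false = ⊥-elim (false≢true (trans (sym g) (trans (ground-delete e i≢e) (cong not l))))

  pStar-coloop : ∀ σ → isColoop M i ≡ true → pStar M i σ ≡ ⁅ i ⁆ ∷ List.map (λ F → F ∪ ⁅ i ⁆) σ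
  pStar-coloop σ c rewrite c = refl

  pStar-noncoloop : ∀ σ → isColoop M i ≡ false → pStar M i σ ≡ List.map (λ F → cl M F ─ L) σ
  pStar-noncoloop σ c rewrite c = refl

  signOf-ground-zer⇒loop : ∀ ε e → i ≢ e → lookup (signOf G ε) e ≡ zer → lookup L e ≡ true
  signOf-ground-zer⇒loop ε e i≢e r = ground-false⇒loop e i≢e (signOf-zer⁻ G ε e r)

  record DeletionFlat (F : Subset n) : Set where
    field
      avoids : ∀ e → lookup F e ≡ true → i ≢ e
      closure⊆ : ∀ e → i ≢ e → lookup (cl M F) e ≡ true → lookup F e ≡ false → lookup L e ≡ true

  flat⇒DeletionFlat : ∀ F → IsFlat (contractSet R (loops R)) F → DeletionFlat F
  flat⇒DeletionFlat _ (_ , Y∈ , refl) with ∈cov-contract-loops⁻ Y∈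
  ... | X , X∈ , refl = record { avoids = avoids ; closure⊆ = closure⊆ }
    where
    F = zeroSet (contractSet R (loops R)) (pS ⁅ i ⁆ X)
    avoids : ∀ e → lookup F e ≡ true → i ≢ e
    avoids e r = ground⇒≢ e (proj₁ (∧-true⁻ (trans (sym (lookup-zeroSet (contractSet R (loops R)) _ e)) r)))
    X-zeroOn : ZeroOn F X
    X-zeroOn e r = trans (sym (lookup-pS-⁅x⁆-y i X e (avoids e r))) (zeroSet⇒zer (contractSet R (loops R)) _ e r)
    closure⊆ : ∀ e → i ≢ e → lookup (cl M F) e ≡ true → lookup F e ≡ false → lookup L e ≡ true
    closure⊆ e i≢e c f with lookup G e in g
    ... | false = ground-false⇒loop e i≢e g
    ... | true = ⊥-elim (false≢true (trans (sym f) (zer⇒zeroSet (contractSet R (loops R)) _ e g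
                   (trans (lookup-pS-⁅x⁆-y i X e i≢e) (∈cl⁻ F e c X∈ X-zeroOn)))))

  facet-flats : ∀ σ → IsFacet (M ∖ₘ i) σ → All DeletionFlat σ
  facet-flats σ (flats , _) = All.map (flat⇒DeletionFlat _) flats

  facet-increasing : ∀ σ → IsFacet (M ∖ₘ i) σ → AllPairs _⊆_ σ
  facet-increasing σ (_ , chain) =
    AllPairs-++⁻ˡ σ (Linked⇒AllPairs ⊆-trans (Linked.map (proj₁ ∘ proj₁) (Linked.tail chain)))

  pS-flat : ∀ {F} → DeletionFlat F → ∀ {T} → T ∈ᴸ C → pS F (pS ⁅ i ⁆ T) ≡ pS ⁅ i ⁆ (pS (cl M F) T)
  pS-flat {F} flat {T} T∈ = lookup-ext pointwise
    where
    open DeletionFlat flat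
    pointwise : ∀ e → lookup (pS F (pS ⁅ i ⁆ T)) e ≡ lookup (pS ⁅ i ⁆ (pS (cl M F) T)) e
    pointwise e with i ≟ᶠ e
    ... | yes refl = trans (lookup-pS-zer F _ i (lookup-pS-⁅x⁆-x i T)) (sym (lookup-pS-⁅x⁆-x i _))
    ... | no i≢e rewrite lookup-pS-⁅x⁆-y i (pS (cl M F) T) e i≢e with lookup F e in f
    ...   | true = trans (lookup-pS-true F _ e f) (sym (lookup-pS-true (cl M F) T e (cl-extensive F e f)))
    ...   | false rewrite lookup-pS-false F (pS ⁅ i ⁆ T) e f | lookup-pS-⁅x⁆-y i T e i≢e
      with lookup (cl M F) e in c
    ...     | true = trans (loopsOn T∈ e (closure⊆ e i≢e c f)) (sym (lookup-pS-true (cl M F) T e c))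
    ...     | false = sym (lookup-pS-false (cl M F) T e c)

  chain-pStar⁻ : ∀ σ → IsFacet (M ∖ₘ i) σ → ∀ {T} → T ∈ᴸ C → All (λ F → pS F T ∈ᴸ C) (pStar M i σ) →
                 All (λ F → pS F (pS ⁅ i ⁆ T) ∈ᴸ cov R∖loops) σ
  chain-pStar⁻ σ facet {T} T∈ chain with isColoop M i
  chain-pStar⁻ σ facet {T} T∈ (_ ∷ chain′) | true =
    All.map (λ {F} p → subst (_∈ᴸ cov R∖loops) (sym (pS-pS-⁅x⁆ F i T)) (∈cov⁺ p)) (All.map⁻ chain′)
  chain-pStar⁻ σ facet {T} T∈ chain | false = All.zipWith
    (λ {F} (flat , p) → subst (_∈ᴸ cov R∖loops) (sym (pS-flat flat T∈))
                          (∈cov⁺ (subst (_∈ᴸ C) (pS-─ (cl M F) L T (loopsOn T∈)) p)))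
    (facet-flats σ facet , All.map⁻ chain)

  delete⇐ : ∀ σ ε → IsFacet (M ∖ₘ i) σ → deletePhase M i (phase M) σ ε → phase (M ∖ₘ i) σ ε
  delete⇐ σ ε facet (δ , ph , refl) = vanishes , (S∈ , maximal) , chainS
    where
    open Phase (phase-elim (pStar M i σ) δ ph)
    T = topeOf δ
    S = signOf G (pB ⁅ i ⁆ δ)
    S≡ : S ≡ pS ⁅ i ⁆ T
    S≡ = signOf-pB ⁅ i ⁆ G (⊤ ─ L) δ ⁅x⁆∩ground≡∅ λ e r →
      trans (ground-delete e (λ { refl → false≢true (trans (sym r) (lookup-⁅x⁆-x i)) })) (sym (lookup-⊤─ L e))
    vanishes : ∀ e → e ∉ G → lookup (pB ⁅ i ⁆ δ) e ≡ false
    vanishes e e∉ with i ≟ᶠ e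
    ... | yes refl = lookup-pB-true ⁅ i ⁆ δ i (lookup-⁅x⁆-x i)
    ... | no i≢e = trans (lookup-pB-false ⁅ i ⁆ δ e (lookup-⁅x⁆-y i e i≢e))
                         (vanishes-on-loops e (ground-false⇒loop e i≢e (∉⇒false G e e∉)))
    S∈ : S ∈ᴸ cov R∖loops
    S∈ = subst (_∈ᴸ cov R∖loops) (sym S≡) (∈cov⁺ tope-∈)
    maximal : ∀ Y → Y ∈ᴸ cov R∖loops → S ≼ Y → Y ≡ S
    maximal Y Y∈ with ∈cov⁻ Y∈
    ... | X , X∈ , refl = ≼-zeros⇒≡ S _ zeros⊆
      where
      zeros⊆ : ∀ e → lookup S e ≡ zer → lookup (pS ⁅ i ⁆ X) e ≡ zer
      zeros⊆ e S≡0 with i ≟ᶠ e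
      ... | yes refl = lookup-pS-⁅x⁆-x i X
      ... | no i≢e = trans (lookup-pS-⁅x⁆-y i X e i≢e) (loopsOn X∈ e (signOf-ground-zer⇒loop _ e i≢e S≡0))
    chainS : All (λ F → pS F S ∈ᴸ cov R∖loops) σ
    chainS = subst (λ V → All (λ F → pS F V ∈ᴸ cov R∖loops) σ) (sym S≡) (chain-pStar⁻ σ facet tope-∈ chain-∈)

  coloop-witness : isColoop M i ≡ true →
                   Σ (SignVec n) λ H → H ∈ᴸ C × (∀ e → i ≢ e → lookup H e ≡ zer) × lookup H i ≢ zer
  coloop-witness c with find (invert (subst (Reflects _) c (proof (any? (λ X → ≡-dec Bool._≟_ (⊤ ─ ⁅ i ⁆) (zeroSet M X)) C))))
  ... | H , H∈ , ⊤─⁅x⁆≡zeros = H , H∈ , off , at-x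
    where
    off : ∀ e → i ≢ e → lookup H e ≡ zer
    off e i≢e = zeroSet⇒zer M H e (subst (λ V → lookup V e ≡ true) ⊤─⁅x⁆≡zeros (⊤─⁅x⁆-y i e i≢e))
    at-x : lookup H i ≢ zer
    at-x Hi≡0 = false≢true (trans (sym (⊤─⁅x⁆-x i))
      (subst (λ V → lookup V i ≡ true) (sym ⊤─⁅x⁆≡zeros) (zer⇒zeroSet M H i (lookup-⊤ i) Hi≡0)))

  module Coloop (H : SignVec n) (H∈ : H ∈ᴸ C) (H-off : ∀ e → i ≢ e → lookup H e ≡ zer) (Hi≢0 : lookup H i ≢ zer) where

    opposite : ∀ s → s ≢ zer →
               Σ (SignVec n) λ H′ → H′ ∈ᴸ C × (∀ e → i ≢ e → lookup H′ e ≡ zer) × lookup H′ i ≡ -sgn s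
    opposite s s≢0 with nonzero-signs Hi≢0 s≢0
    ... | inj₁ Hi≡s = negV H , cov-neg H∈ , (λ e i≢e → trans (lookup-negV H e) (cong -sgn (H-off e i≢e))) ,
                      trans (lookup-negV H i) (cong -sgn Hi≡s)
    ... | inj₂ Hi≡-s = H , H∈ , H-off , Hi≡-s

    eliminate : ∀ {Y} → Y ∈ᴸ C → lookup Y i ≢ zer → pS ⁅ i ⁆ Y ∈ᴸ C
    eliminate {Y} Y∈ Yi≢0 with opposite (lookup Y i) Yi≢0
    ... | H′ , H′∈ , H′-off , H′i with cov-elim Y∈ H′∈ i (Yi≢0 , sym (trans (cong -sgn H′i) (-sgn-involutive _)))
    ... | Z , Z∈ , Zi≡0 , Z-agrees = subst (_∈ᴸ C) (lookup-ext pointwise) Z∈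
      where
      pointwise : ∀ e → lookup Z e ≡ lookup (pS ⁅ i ⁆ Y) e
      pointwise e with i ≟ᶠ e
      ... | yes refl = trans Zi≡0 (sym (lookup-pS-⁅x⁆-x i Y))
      ... | no i≢e = begin
        lookup Z e                          ≡⟨ Z-agrees e (λ (Ye≢0 , Ye≡) → Ye≢0 (trans Ye≡ (cong -sgn (H′-off e i≢e)))) ⟩
        lookup (Y ∘ˢ H′) e                  ≡⟨ lookup-∘ˢ Y H′ e ⟩
        compS (lookup Y e) (lookup H′ e)    ≡⟨ cong (compS (lookup Y e)) (H′-off e i≢e) ⟩
        compS (lookup Y e) zer              ≡⟨ compS-zerʳ (lookup Y e) ⟩
        lookup Y e                          ≡⟨ lookup-pS-⁅x⁆-y i Y e i≢e ⟨
        lookup (pS ⁅ i ⁆ Y) e               ∎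

    pS-⁅x⁆-∈ : ∀ {Y} → Y ∈ᴸ C → pS ⁅ i ⁆ Y ∈ᴸ C
    pS-⁅x⁆-∈ {Y} Y∈ with isZero (lookup Y i) in z
    ... | true = subst (_∈ᴸ C) (sym (pS-zeroOn-⁅x⁆ i Y (isZero⇒≡zer z))) Y∈
    ... | false = eliminate Y∈ (λ Yi≡0 → false≢true (trans (sym z) (≡zer⇒isZero Yi≡0)))

  module Forward (ε : Vec Bool n) {X₀ : SignVec n} (X₀∈ : X₀ ∈ᴸ C) (X₀-restricts : pS ⁅ i ⁆ X₀ ≡ signOf G ε) where

    S : SignVec n
    S = signOf G ε

    Extension : Subset n → Set
    Extension F = Σ (SignVec n) λ Y → Y ∈ᴸ C × pS ⁅ i ⁆ Y ≡ pS F S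

    SignedExtension : Subset n → Sign → Set
    SignedExtension F s = Σ (SignVec n) λ Y → Y ∈ᴸ C × pS ⁅ i ⁆ Y ≡ pS F S × lookup Y i ≡ s

    extension : ∀ {F} → pS F S ∈ᴸ cov R∖loops → Extension F
    extension p with ∈cov⁻ p
    ... | Y , Y∈ , eq = Y , Y∈ , sym eq

    extension-zeroOn : ∀ {F Y} → DeletionFlat F → pS ⁅ i ⁆ Y ≡ pS F S → ZeroOn F Y
    extension-zeroOn {F} {Y} flat eq e f = begin
      lookup Y e                 ≡⟨ lookup-pS-⁅x⁆-y i Y e (DeletionFlat.avoids flat e f) ⟨
      lookup (pS ⁅ i ⁆ Y) e      ≡⟨ cong (λ V → lookup V e) eq ⟩
      lookup (pS F S) e          ≡⟨ lookup-pS-true F S e f ⟩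
      zer                        ∎

    S-zer⇒loop : ∀ e → i ≢ e → lookup S e ≡ zer → lookup L e ≡ true
    S-zer⇒loop = signOf-ground-zer⇒loop ε

    base : SignVec n
    base = X₀ ∘ˢ fullCovector

    base-∈ : base ∈ᴸ C
    base-∈ = cov-comp X₀∈ fullCovector-∈

    base-full : Full base
    base-full = full-∘ˢ X₀ fullCovector-full

    pS-base : pS ⁅ i ⁆ base ≡ S
    pS-base = pS-∘ˢ-absorb ⁅ i ⁆ X₀ fullCovector S X₀-restricts λ e r S≡0 →
      loopsOn fullCovector-∈ e (S-zer⇒loop e (lookup-⁅x⁆-false⇒≢ i e r) S≡0)

    pS-cl≡ : ∀ {F} → DeletionFlat F → ∀ {T Y} → pS ⁅ i ⁆ T ≡ S → Y ∈ᴸ C → pS ⁅ i ⁆ Y ≡ pS F S →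
             lookup (pS (cl M F) T) i ≡ lookup Y i → pS (cl M F) T ≡ Y
    pS-cl≡ {F} flat {T} {Y} T-restricts Y∈ Y-extends at-x = lookup-ext pointwise
      where
      pointwise : ∀ e → lookup (pS (cl M F) T) e ≡ lookup Y e
      pointwise e with i ≟ᶠ e
      ... | yes refl = at-x
      ... | no i≢e with lookup (cl M F) e in c
      ...   | true = trans (lookup-pS-true (cl M F) T e c) (sym (∈cl⁻ F e c Y∈ (extension-zeroOn flat Y-extends)))
      ...   | false = begin
        lookup (pS (cl M F) T) e   ≡⟨ lookup-pS-false (cl M F) T e c ⟩
        lookup T e                 ≡⟨ lookup-pS-⁅x⁆-y i T e i≢e ⟨
        lookup (pS ⁅ i ⁆ T) e      ≡⟨ cong (λ V → lookup V e) T-restricts ⟩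
        lookup S e                 ≡⟨ lookup-pS-false F S e F∌e ⟨
        lookup (pS F S) e          ≡⟨ cong (λ V → lookup V e) Y-extends ⟨
        lookup (pS ⁅ i ⁆ Y) e      ≡⟨ lookup-pS-⁅x⁆-y i Y e i≢e ⟩
        lookup Y e                 ∎
        where
        F∌e : lookup F e ≡ false
        F∌e with lookup F e in f
        ... | true = ⊥-elim (false≢true (trans (sym c) (cl-extensive F e f)))
        ... | false = refl

    pS-cl-∈ : ∀ {F} → DeletionFlat F → Extension F → ∀ {T} → pS ⁅ i ⁆ T ≡ S →
              (lookup (cl M F) i ≡ false → SignedExtension F (lookup T i)) → pS (cl M F) T ∈ᴸ C
    pS-cl-∈ {F} flat (Y , Y∈ , Y-extends) {T} T-restricts signed with lookup (cl M F) i in c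
    ... | true = subst (_∈ᴸ C) (sym (pS-cl≡ flat T-restricts Y∈ Y-extends
                   (trans (lookup-pS-true (cl M F) T i c) (sym (∈cl⁻ F i c Y∈ (extension-zeroOn flat Y-extends)))))) Y∈
    ... | false with signed refl
    ...   | Y′ , Y′∈ , Y′-extends , Y′i≡Ti =
      subst (_∈ᴸ C) (sym (pS-cl≡ flat T-restricts Y′∈ Y′-extends
                            (trans (lookup-pS-false (cl M F) T i c) (sym Y′i≡Ti)))) Y′∈

    Closed : Subset n → Set
    Closed F = lookup (cl M F) i ≡ true

    record Lift (τ : List (Subset n)) : Set where
      field
        Y : SignVec n
        Y-∈ : Y ∈ᴸ C
        Yi≢0 : lookup Y i ≢ zer
        below : ∀ {F} → All (F ⊆_) τ → pS ⁅ i ⁆ Y ≼ pS F S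
        signed : All (λ F → lookup (cl M F) i ≡ false → SignedExtension F (lookup Y i)) τ

    lift-start : ∀ {F τ} → lookup (cl M F) i ≡ false → Extension F → All Closed τ → Lift (F ∷ τ)
    lift-start {F} c (Y , Y∈ , Y-extends) closed = record
      { Y = W
      ; Y-∈ = cov-comp Y∈ (closureCovector-∈ F)
      ; Yi≢0 = λ Wi≡0 → false≢true (trans (sym c) (closureCovector-zer F i
                  (proj₂ (compS-zer⁻ {lookup Y i} (trans (sym (lookup-∘ˢ Y _ i)) Wi≡0)))))
      ; below = λ { {F′} (F′⊆F ∷ _) → subst (_≼ pS F′ S) (sym W-extends) (pS-antitone S F′⊆F) }
      ; signed = (λ _ → W , cov-comp Y∈ (closureCovector-∈ F) , W-extends , refl)
                 ∷ All.map (λ closed-F′ open-F′ → ⊥-elim (false≢true (trans (sym open-F′) closed-F′))) closed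
      }
      where
      W = Y ∘ˢ closureCovector F
      W-extends : pS ⁅ i ⁆ W ≡ pS F S
      W-extends = pS-∘ˢ-absorb ⁅ i ⁆ Y _ (pS F S) Y-extends absorbs
        where
        absorbs : ∀ e → lookup ⁅ i ⁆ e ≡ false → lookup (pS F S) e ≡ zer → lookup (closureCovector F) e ≡ zer
        absorbs e r z with lookup F e in f
        ... | true = closureCovector-zeroOn F e f
        ... | false = loopsOn (closureCovector-∈ F) e
                        (S-zer⇒loop e (lookup-⁅x⁆-false⇒≢ i e r) (trans (sym (lookup-pS-false F S e f)) z))

    lift-extend : ∀ {F τ} → All (F ⊆_) τ → Extension F → Lift τ → Lift (F ∷ τ)
    lift-extend {F} F⊆τ (Z , Z∈ , Z-extends) l = record
      { Y = Y
      ; Y-∈ = Y-∈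
      ; Yi≢0 = Yi≢0
      ; below = λ { (_ ∷ F′⊆τ) → below F′⊆τ }
      ; signed = (λ _ → Y ∘ˢ Z , cov-comp Y-∈ Z∈ , YZ-extends , trans (lookup-∘ˢ Y Z i) (compS-nonzero _ Yi≢0)) ∷ signed
      }
      where
      open Lift l
      YZ-extends : pS ⁅ i ⁆ (Y ∘ˢ Z) ≡ pS F S
      YZ-extends = trans (pS-∘ˢ-≼ ⁅ i ⁆ Y Z (subst (pS ⁅ i ⁆ Y ≼_) (sym Z-extends) (below F⊆τ))) Z-extends

    lift : ∀ τ → AllPairs _⊆_ τ → All Extension τ → All Closed τ ⊎ Lift τ
    lift [] [] [] = inj₁ []
    lift (F ∷ τ) (F⊆τ ∷ increasing) (ext ∷ exts) with lift τ increasing exts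
    ... | inj₂ l = inj₂ (lift-extend F⊆τ ext l)
    ... | inj₁ closed with lookup (cl M F) i in c
    ...   | true = inj₁ (c ∷ closed)
    ...   | false = inj₂ (lift-start c ext closed)

    record Candidate (τ : List (Subset n)) : Set where
      field
        T : SignVec n
        T-∈ : T ∈ᴸ C
        T-full : Full T
        T-restricts : pS ⁅ i ⁆ T ≡ S
        T-signed : All (λ F → lookup (cl M F) i ≡ false → SignedExtension F (lookup T i)) τ

    candidate : ∀ τ → AllPairs _⊆_ τ → All Extension τ → Candidate τ
    candidate τ increasing exts with lift τ increasing exts
    ... | inj₁ closed = record
      { T = base ; T-∈ = base-∈ ; T-full = base-full ; T-restricts = pS-base
      ; T-signed = All.map (λ closed-F open-F → ⊥-elim (false≢true (trans (sym open-F) closed-F))) closed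
      }
    ... | inj₂ l = record
      { T = Y ∘ˢ base ; T-∈ = cov-comp Y-∈ base-∈ ; T-full = full-∘ˢ Y base-full
      ; T-restricts = trans (pS-∘ˢ-≼ ⁅ i ⁆ Y base Y≼base) pS-base
      ; T-signed = All.map (λ s c → subst (SignedExtension _) (sym Ti≡Yi) (s c)) signed
      }
      where
      open Lift l
      Y≼base : pS ⁅ i ⁆ Y ≼ pS ⁅ i ⁆ base
      Y≼base = subst (pS ⁅ i ⁆ Y ≼_) (trans (pS-∅ S) (sym pS-base)) (below (All.tabulate (λ {G} _ → ⊆-min G)))
      Ti≡Yi : lookup (Y ∘ˢ base) i ≡ lookup Y i
      Ti≡Yi = trans (lookup-∘ˢ Y base i) (compS-nonzero _ Yi≢0)

    record Tope (σ : List (Subset n)) : Set where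
      field
        T : SignVec n
        T-∈ : T ∈ᴸ C
        T-full : Full T
        T-restricts : pS ⁅ i ⁆ T ≡ S
        T-chain : All (λ F → pS F T ∈ᴸ C) (pStar M i σ)

    coloop-chain : isColoop M i ≡ true → ∀ σ → All (λ F → pS F S ∈ᴸ cov R∖loops) σ →
                   All (λ F → pS F base ∈ᴸ C) (pStar M i σ)
    coloop-chain c σ chain with coloop-witness c
    ... | H , H∈ , H-off , Hi≢0 = subst (All (λ F → pS F base ∈ᴸ C)) (sym (pStar-coloop σ c))
                                    (pS-⁅x⁆-∈ base-∈ ∷ All.map⁺ (All.map extend chain))
      where
      open Coloop H H∈ H-off Hi≢0
      extend : ∀ {F} → pS F S ∈ᴸ cov R∖loops → pS (F ∪ ⁅ i ⁆) base ∈ᴸ C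
      extend {F} p with extension p
      ... | Y , Y∈ , Y-extends = subst (_∈ᴸ C) eq (pS-⁅x⁆-∈ Y∈)
        where
        eq : pS ⁅ i ⁆ Y ≡ pS (F ∪ ⁅ i ⁆) base
        eq = begin
          pS ⁅ i ⁆ Y            ≡⟨ Y-extends ⟩
          pS F S                ≡⟨ cong (pS F) pS-base ⟨
          pS F (pS ⁅ i ⁆ base)  ≡⟨ pS-∪ F ⁅ i ⁆ base ⟨
          pS (F ∪ ⁅ i ⁆) base   ∎

    tope : ∀ σ → IsFacet (M ∖ₘ i) σ → All (λ F → pS F S ∈ᴸ cov R∖loops) σ → Tope σ
    tope σ facet chain with isColoop M i in c
    ... | true = record
      { T = base ; T-∈ = base-∈ ; T-full = base-full ; T-restricts = pS-base ; T-chain = coloop-chain c σ chain }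
    ... | false = record
      { T = T ; T-∈ = T-∈ ; T-full = T-full ; T-restricts = T-restricts
      ; T-chain = subst (All (λ F → pS F T ∈ᴸ C)) (sym (pStar-noncoloop σ c))
                    (All.map⁺ (All.map (λ {F} p → subst (_∈ᴸ C) (sym (pS-─ (cl M F) L T (loopsOn T-∈))) p) closures))
      }
      where
      exts = All.map extension chain
      open Candidate (candidate σ (facet-increasing σ facet) exts)
      closures : All (λ F → pS (cl M F) T ∈ᴸ C) σ
      closures = All.zipWith (λ (flat , ext , signed) → pS-cl-∈ flat ext T-restricts signed)
                             (facet-flats σ facet , All.zip (exts , T-signed))

  delete⇒ : ∀ σ ε → IsFacet (M ∖ₘ i) σ → phase (M ∖ₘ i) σ ε → deletePhase M i (phase M) σ ε
  delete⇒ σ ε facet (vanishes , (S∈ , _) , chain) with ∈cov⁻ S∈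
  ... | X₀ , X₀∈ , S≡ = phaseOf T , phase-intro (pStar M i σ) T-∈ T-full T-chain ,
                        sym (pB-phaseOf ⁅ i ⁆ G ε T (λ e g → vanishes e (false⇒∉ G e g)) ⁅x⁆∩ground≡∅ T-restricts)
    where
    open Forward ε X₀∈ (sym S≡)
    open Tope (tope σ facet chain)

proposition3p12 : ∀ {n} (C : List (SignVec n)) → IsOrientedMatroid (mkOM ⊤ C) → (i : Fin n) →
    (∀ (σ : List (Subset n)) → IsFacet (mkOM ⊤ C /ₘ i) σ → ∀ (ε : Vec Bool n) →
      phase (mkOM ⊤ C /ₘ i) σ ε ⇔ contractPhase (mkOM ⊤ C) i (phase (mkOM ⊤ C)) σ ε)
    × (∀ (σ : List (Subset n)) → IsFacet (mkOM ⊤ C ∖ₘ i) σ → ∀ (ε : Vec Bool n) →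
      phase (mkOM ⊤ C ∖ₘ i) σ ε ⇔ deletePhase (mkOM ⊤ C) i (phase (mkOM ⊤ C)) σ ε)
proposition3p12 C om i =
  -- The contraction identity holds for every chain σ, not only for facets.
  (λ σ _ ε → mk⇔ (contract⇒ σ ε) (contract⇐ σ ε)) ,
  (λ σ facet ε → mk⇔ (delete⇒ σ ε facet) (delete⇐ σ ε facet))
  where
  open Contraction C om i using (contract⇒; contract⇐)
  open Deletion C om i using (delete⇒; delete⇐)
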